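{- Let $X$ be a sock ordering and let $x$ be a color of $X$ that is unsortable in $X$ and is one of the first two distinct colors to appear in $X$. Then every color that appears after the final sock of color $x$ in $X$ is blocked in $X$ by a sandwich containing the color $x$.
   Context: Sock orderings are finite words of colored socks written as words over colors; $Y\subseteq X$ means $Y$ is a subsequence of $X$. A sandwich is a word $uvu$ with colors $u\ne v$; it blocks a color $z\notin\{u,v\}$ in $X$ if $uvuz\subseteq X$. A color $x$ is sortable in $X$ (i.e. in the state $(\emptyset,X)$ of foot-sorting) if $x$ is not blocked by any sandwich in $X$; otherwise it is unsortable. -}

module Defs where

open import Data.Nat using (ℕ; suc)
open import Data.List using (List; []; _∷_; _++_; replicate)
open import Data.List.Relation.Binary.Sublist.Propositional using (_⊆_)
open import Data.List.Membership.Propositional using (_∈_; _∉_)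
open import Data.Product using (Σ; ∃; ∃-syntax; _×_; _,_)
open import Data.Sum using (_⊎_)
open import Relation.Binary.PropositionalEquality using (_≡_; _≢_)

Color : Set
Color = ℕ

SockOrdering : Set
SockOrdering = List Color

Blocks : Color → Color → Color → SockOrdering → Set
Blocks u v z X = u ≢ v × z ≢ u × z ≢ v × (u ∷ v ∷ u ∷ z ∷ []) ⊆ X

Unsortable : Color → SockOrdering → Set
Unsortable x X = ∃[ u ] ∃[ v ] Blocks u v x X

FirstTwoColor : Color → SockOrdering → Set
FirstTwoColor x X =
  (∃[ rest ] X ≡ x ∷ rest)
  ⊎ (∃[ y ] ∃[ k ] ∃[ rest ] (y ≢ x × X ≡ replicate (suc k) y ++ x ∷ rest))

AfterLast : Color → Color → SockOrdering → Set
AfterLast x z X = ∃[ A ] ∃[ B ] (X ≡ A ++ x ∷ B × x ∉ B × z ∈ B)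

{-# OPTIONS --safe #-}
module Submission where

-- Write X = A x B with x ∉ B, and let u v u x ⊆ X block x. As x ∉ B, the
-- sandwich u v u already lies in A. Since x is one of the first two colors,
-- X = y^k x R; a sandwich cannot live in the monochromatic prefix y^k, so A
-- extends past this first x and both u and v occur after it. Hence x u x z
-- and x v x z are subsequences of X for every z ∈ B, and z differs from at
-- least one of u, v.

open import Defs
open import Level using (Level)
open import Function using (_∘_)
open import Data.Nat using (zero; suc; _≟_)
open import Data.Product using (∃-syntax; _×_; _,_; proj₁; proj₂)
open import Data.Sum using (_⊎_; inj₁; inj₂)
open import Data.Empty using (⊥-elim)
open import Data.List using (List; []; _∷_; _++_; [_]; replicate)
open import Data.List.Properties using (∷-injective; ++-identityʳ)
open import Data.List.Membership.Propositional using (_∈_; _∉_)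
open import Data.List.Membership.Propositional.Properties using (∈-++⁺ʳ)
open import Data.List.Relation.Unary.Any using (here; tail)
open import Data.List.Relation.Binary.Sublist.Propositional
  using (_⊆_; _∷_; _∷ʳ_; minimum; to∈; from∈; ⊆-refl; ⊆-trans)
open import Data.List.Relation.Binary.Sublist.Propositional.Properties
  using (∷ˡ⁻; ∷⁻; ++⁺; ++⁺ˡ; ++⁺ʳ; Any-resp-⊆)
open import Relation.Binary.PropositionalEquality
  using (_≡_; _≢_; refl; sym; trans; cong; subst; ≢-sym)
open import Relation.Nullary using (Dec; yes; no; ¬_)

private
  variable
    ℓ : Level
    A : Set ℓ
    u v w x y : A
    ws : List A

⊆-before-last : ∀ ws xs ys → ws ++ [ x ] ⊆ xs ++ x ∷ ys → x ∉ ys → ws ⊆ xs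
⊆-before-last []       xs       ys _          _    = minimum xs
⊆-before-last (w ∷ ws) []       ys τ          x∉ys =
  ⊥-elim (x∉ys (Any-resp-⊆ (∷⁻ τ) (∈-++⁺ʳ ws (here refl))))
⊆-before-last (w ∷ ws) (c ∷ xs) ys (_ ∷ʳ τ)   x∉ys = c ∷ʳ ⊆-before-last (w ∷ ws) xs ys τ x∉ys
⊆-before-last (w ∷ ws) (c ∷ xs) ys (w≡c ∷ τ)  x∉ys = w≡c ∷ ⊆-before-last ws xs ys τ x∉ys

∷⊆replicate-++⁻ : ∀ k {ys} → w ≢ y → w ∷ ws ⊆ replicate k y ++ ys → w ∷ ws ⊆ ys
∷⊆replicate-++⁻ zero    w≢y τ          = τ
∷⊆replicate-++⁻ (suc k) w≢y (_ ∷ʳ τ)   = ∷⊆replicate-++⁻ k w≢y τ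
∷⊆replicate-++⁻ (suc k) w≢y (w≡y ∷ τ)  = ⊥-elim (w≢y w≡y)

sandwich⊆replicate-++⁻ : ∀ k {ys} → u ≢ v →
  u ∷ v ∷ u ∷ [] ⊆ replicate k y ++ ys → u ∈ ys × v ∈ ys
sandwich⊆replicate-++⁻ zero    u≢v τ         = to∈ τ , to∈ (∷ˡ⁻ τ)
sandwich⊆replicate-++⁻ (suc k) u≢v (_ ∷ʳ τ)  = sandwich⊆replicate-++⁻ k u≢v τ
sandwich⊆replicate-++⁻ (suc k) u≢v (refl ∷ τ) =
  let vu⊆ys = ∷⊆replicate-++⁻ k (≢-sym u≢v) τ in to∈ (∷ˡ⁻ vu⊆ys) , to∈ vu⊆ys

sandwich⊈replicate : ∀ k → u ≢ v → ¬ (u ∷ v ∷ u ∷ [] ⊆ replicate k y)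
sandwich⊈replicate k u≢v τ
  with () ← proj₁ (sandwich⊆replicate-++⁻ k u≢v (subst (_ ⊆_) (sym (++-identityʳ _)) τ))

++≡++∷-split : ∀ (xs ps : List A) {ys zs} → xs ++ ys ≡ ps ++ x ∷ zs →
  (∃[ xs′ ] xs ≡ ps ++ x ∷ xs′) ⊎ (∃[ ps′ ] ps ≡ xs ++ ps′)
++≡++∷-split []       ps       eq = inj₂ (ps , refl)
++≡++∷-split (c ∷ xs) []       eq with ∷-injective eq
... | refl , _ = inj₁ (xs , refl)
++≡++∷-split (c ∷ xs) (p ∷ ps) eq with ∷-injective eq
... | refl , eq′ with ++≡++∷-split xs ps eq′
...   | inj₁ (xs′ , xs≡) = inj₁ (xs′ , cong (c ∷_) xs≡)
...   | inj₂ (ps′ , ps≡) = inj₂ (ps′ , cong (c ∷_) ps≡)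

FirstTwoColor⇒replicate-++ : ∀ {x X} → FirstTwoColor x X →
  ∃[ y ] ∃[ k ] ∃[ R ] X ≡ replicate k y ++ x ∷ R
FirstTwoColor⇒replicate-++ {x} (inj₁ (R , eq))          = x , zero , R , eq
FirstTwoColor⇒replicate-++     (inj₂ (y , k , R , _ , eq)) = y , suc k , R , eq

FirstTwoColor-precedes-sandwich : ∀ {x u v : Color} A {B} → FirstTwoColor x (A ++ B) →
  u ≢ v → x ≢ u → x ≢ v → u ∷ v ∷ u ∷ [] ⊆ A →
  x ∷ [ u ] ⊆ A × x ∷ [ v ] ⊆ A
FirstTwoColor-precedes-sandwich {x} A first u≢v x≢u x≢v uvu⊆A
  with FirstTwoColor⇒replicate-++ first
... | y , k , R , eq with ++≡++∷-split A (replicate k y) eq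
...   | inj₁ (A′ , refl) =
  let u∈ , v∈ = sandwich⊆replicate-++⁻ k u≢v uvu⊆A
  in  x-then (tail (≢-sym x≢u) u∈) , x-then (tail (≢-sym x≢v) v∈)
  where
  x-then : ∀ {w} → w ∈ A′ → x ∷ [ w ] ⊆ replicate k y ++ x ∷ A′
  x-then w∈A′ = ++⁺ˡ (replicate k y) (refl ∷ from∈ w∈A′)
...   | inj₂ (P , y^k≡A++P) =
  ⊥-elim (sandwich⊈replicate k u≢v
    (subst (_ ⊆_) (sym y^k≡A++P) (⊆-trans uvu⊆A (++⁺ʳ P ⊆-refl))))

lemma4p2 : (X : SockOrdering) (x : Color) →
    Unsortable x X → FirstTwoColor x X →
    ∀ z → AfterLast x z X →
    ∃[ u ] ∃[ v ] ((u ≡ x ⊎ v ≡ x) × Blocks u v z X)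
lemma4p2 X x (u , v , u≢v , x≢u , x≢v , uvux⊆X) first z (A , B , refl , x∉B , z∈B) =
  blocker (z ≟ u)
  where
  z≢x : z ≢ x
  z≢x refl = x∉B z∈B

  x-then-u,v : x ∷ [ u ] ⊆ A × x ∷ [ v ] ⊆ A
  x-then-u,v = FirstTwoColor-precedes-sandwich A first u≢v x≢u x≢v
                 (⊆-before-last (u ∷ v ∷ u ∷ []) A B uvux⊆X x∉B)

  x-w-x-z : ∀ {w} → x ∷ [ w ] ⊆ A → x ∷ w ∷ x ∷ z ∷ [] ⊆ A ++ x ∷ B
  x-w-x-z xw⊆A = ++⁺ xw⊆A (refl ∷ from∈ z∈B)

  blocker : Dec (z ≡ u) →
    ∃[ u′ ] ∃[ v′ ] ((u′ ≡ x ⊎ v′ ≡ x) × Blocks u′ v′ z (A ++ x ∷ B))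
  blocker (no z≢u)  =
    x , u , inj₁ refl , x≢u , z≢x , z≢u , x-w-x-z (proj₁ x-then-u,v)
  blocker (yes z≡u) =
    x , v , inj₁ refl , x≢v , z≢x , u≢v ∘ trans (sym z≡u) , x-w-x-z (proj₂ x-then-u,v)
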